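{- For all $n\ge 1$ and $k\in[n]$, the left-to-right code $\psi$ restricts to a bijection from $\mathcal{DU}_{n,k}$ onto $\mathcal{ES}_{n,k}$. Consequently $|\mathcal{ES}_{n,k}|=E_{n,k}$ for all $1\le k\le n$.
   Context: $[n]=\{1,\dots,n\}$. For a finite set $I\subset\mathbb{N}$, a down-up permutation of $I$ is a word $\pi=\pi_1\cdots\pi_m$ using each element of $I$ once with $\pi_1>\pi_2<\pi_3>\cdots$. $\mathcal{DU}_n$ is the set of down-up permutations of $[n]$, $\mathcal{DU}_{n,k}$ the subset with $\pi_1=k$, and $E_{n,k}=|\mathcal{DU}_{n,k}|$. Left-to-right code $\psi(\pi)$ of $\pi\in\mathcal{DU}_n$: start with $I=[n]$, the word $\pi$ and the empty sequence $\Delta$. While $|I|\ge 2$: if some $a\in I$ satisfies $\pi_1>a>\pi_2$, let $a'$ be the largest such $a$, append the domino $(\pi_1,a')$ to $\Delta$, and replace $\pi$ by the word obtained by exchanging the values $\pi_1$ and $a'$ (the result is again down-up on $I$); otherwise append the starred domino $(\pi_1,\pi_2)^*$ to $\Delta$, delete the first two letters of $\pi$ and remove $\pi_1,\pi_2$ from $I$. If finally $I=\{a\}$ is a singleton, append $(a)^*$ and stop (this happens with $a=n$). Then $\psi(\pi)=\Delta$. A domino on $[n]$ is an ordered pair $(j,i)$ with $1\le i<j\le n$; a starred domino on $[n]$ is $(j,i)^*$ with $1\le i<j\le n$, or $(n)^*=(n,n)^*$. A word $\Delta=\Delta_1\cdots\Delta_r$ of dominos and starred dominos is an encoding sequence of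 $[n]$ if: (i) the entries of the starred dominos are pairwise disjoint and their union is $[n]$; (ii) if $\Delta_\ell=(j,i)^*$, then the next letter (if any) has first entry $>i$, and no entry of any later letter lies strictly between $i$ and $j$; (iii) if $\Delta_\ell=(j,i)$, then both $i$ and $j$ appear in some later letter, $i$ is the first entry of the next letter, and each integer strictly between $i$ and $j$ appears in an earlier starred domino. $\mathcal{ES}_{n,k}$ is the set of encoding sequences of $[n]$ whose first letter has first entry $k$ (for $k\ge2$ these are exactly those starting with $(k,k-1)$ or $(k,k-1)^*$). -}

module Defs where

open import Data.Nat using (ℕ; zero; suc; _+_; _*_; _≤_; _<_; _>_; _≡ᵇ_; _<ᵇ_; _⊔_)
open import Data.Bool using (Bool; true; false; if_then_else_; _∧_)
open import Data.Maybe using (Maybe; just; nothing)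
open import Data.List using (List; []; _∷_; _++_; map; foldr; concatMap; length)
open import Data.List.Relation.Unary.All using (All)
open import Data.List.Relation.Unary.Any using (Any)
open import Data.List.Relation.Unary.Unique.Propositional using (Unique)
open import Data.List.Membership.Propositional using (_∈_)
open import Data.Product using (_×_; ∃; Σ)
open import Data.Sum using (_⊎_)
open import Data.Unit using (⊤)
open import Relation.Nullary using (¬_)
open import Relation.Binary.PropositionalEquality using (_≡_)
open import Function.Bundles using (_⇔_)

IsPermOf[_] : ℕ → List ℕ → Set
IsPermOf[ n ] π = Unique π × (∀ x → (x ∈ π) ⇔ (1 ≤ x × x ≤ n))

data DownUp : List ℕ → Set
data UpDown : List ℕ → Set
data DownUp where
  du[]  : DownUp []
  du[_] : ∀ x → DownUp (x ∷ [])
  du∷   : ∀ {x y rest} → x > y → UpDown (y ∷ rest) → DownUp (x ∷ y ∷ rest)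
data UpDown where
  ud[]  : UpDown []
  ud[_] : ∀ x → UpDown (x ∷ [])
  ud∷   : ∀ {x y rest} → x < y → DownUp (y ∷ rest) → UpDown (x ∷ y ∷ rest)

DU : ℕ → List ℕ → Set
DU n π = IsPermOf[ n ] π × DownUp π

DUk : ℕ → ℕ → List ℕ → Set
DUk n k π = DU n π × ∃ λ rest → π ≡ k ∷ rest

-- Dominos.  dom j i = (j,i),  star j i = (j,i)*,  and (n)* = star n n.

data Domino : Set where
  dom  : ℕ → ℕ → Domino
  star : ℕ → ℕ → Domino

firstEntry : Domino → ℕ
firstEntry (dom j i)  = j
firstEntry (star j i) = j

entries : Domino → List ℕ
entries (dom j i)  = j ∷ i ∷ []
entries (star j i) = if j ≡ᵇ i then j ∷ [] else j ∷ i ∷ []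

starEntries : List Domino → List ℕ
starEntries []              = []
starEntries (dom j i ∷ ds)  = starEntries ds
starEntries (star j i ∷ ds) = entries (star j i) ++ starEntries ds

largestBetween : ℕ → ℕ → List ℕ → Maybe ℕ
largestBetween lo hi = foldr step nothing
  where
  maxM : ℕ → Maybe ℕ → Maybe ℕ
  maxM x nothing  = just x
  maxM x (just y) = just (x ⊔ y)
  step : ℕ → Maybe ℕ → Maybe ℕ
  step x acc = if (lo <ᵇ x) ∧ (x <ᵇ hi) then maxM x acc else acc

swapVals : ℕ → ℕ → List ℕ → List ℕ
swapVals a b = map (λ x → if x ≡ᵇ a then b else (if x ≡ᵇ b then a else x))

-- one run of the while-loop, with explicit fuel; the current set I is the
-- set of letters of the current word.
ψ-go : ℕ → List ℕ → List Domino
ψ-go _       []                   = []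
ψ-go _       (a ∷ [])             = star a a ∷ []
ψ-go zero    (p₁ ∷ p₂ ∷ rest)     = []   -- never reached with enough fuel
ψ-go (suc f) (p₁ ∷ p₂ ∷ rest) with largestBetween p₂ p₁ (p₁ ∷ p₂ ∷ rest)
... | just a' = dom p₁ a' ∷ ψ-go f (swapVals p₁ a' (p₁ ∷ p₂ ∷ rest))
... | nothing = star p₁ p₂ ∷ ψ-go f rest

-- ψ on 𝒟𝒰_n; the fuel n*n+2n+1 exceeds the number of loop iterations
ψ : ℕ → List ℕ → List Domino
ψ n π = ψ-go (n * n + 2 * n + 1) π

DominoOn : ℕ → Domino → Set
DominoOn n (dom j i)  = 1 ≤ i × i < j × j ≤ n
DominoOn n (star j i) = (1 ≤ i × i < j × j ≤ n) ⊎ (j ≡ n × i ≡ n)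

NextFirst> : ℕ → List Domino → Set
NextFirst> i []      = ⊤
NextFirst> i (d ∷ _) = firstEntry d > i

NextFirst≡ : ℕ → List Domino → Set
NextFirst≡ i []      = Data.Empty.⊥ where import Data.Empty
NextFirst≡ i (d ∷ _) = firstEntry d ≡ i

LetterCond : List Domino → Domino → List Domino → Set
LetterCond earlier (star j i) later =
  NextFirst> i later ×
  All (λ d → All (λ x → ¬ (i < x × x < j)) (entries d)) later
LetterCond earlier (dom j i) later =
  Any (λ d → i ∈ entries d) later ×
  Any (λ d → j ∈ entries d) later ×
  NextFirst≡ i later ×
  (∀ x → i < x → x < j → x ∈ starEntries earlier)

-- conditions (ii),(iii) at every position
EncCond : List Domino → List Domino → Set
EncCond earlier []       = ⊤
EncCond earlier (d ∷ ds) = LetterCond earlier d ds × EncCond (earlier ++ d ∷ []) ds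

ES : ℕ → List Domino → Set
ES n Δ = All (DominoOn n) Δ × IsPermOf[ n ] (starEntries Δ) × EncCond [] Δ

ESk : ℕ → ℕ → List Domino → Set
ESk n k Δ = ES n Δ × ∃ λ d → ∃ λ rest → Δ ≡ d ∷ rest × firstEntry d ≡ k

HasCard : {A : Set} → (A → Set) → ℕ → Set
HasCard {A} P m = ∃ λ (L : List A) → Unique L × (∀ x → (x ∈ L) ⇔ P x) × length L ≡ m

module Submission where

-- The code is inverted by reading it from right to left: a starred domino
-- (j,i)* puts the deleted pair j i back in front of the word, a domino (j,i)
-- exchanges the values j and i again.  Following the loop of ψ shows that
-- its output satisfies the encoding conditions and that decoding undoes it.
-- Conversely the encoding conditions are exactly what makes every decoding
-- step produce a down-up word on which the loop takes the same step again:
-- after a domino (j,i) the word starts with i, and i is the largest value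
-- between the second letter and j because every value strictly between i and
-- j has already been starred.  The loop terminates within the fuel of ψ since
-- (first letter + n · length) decreases at each iteration.

open import Defs
open import Data.Bool using (true; false; if_then_else_)
open import Data.Empty using (⊥-elim)
open import Data.List using (List; []; _∷_; _++_; map; length)
open import Data.List.Membership.Propositional using (_∈_; _∉_)
open import Data.List.Membership.Propositional.Properties using (∈-map⁺; ∈-map⁻; ∈-upTo⁺; ∈-++⁺ˡ; ∈-++⁺ʳ; ∈-++⁻)
open import Data.List.Properties using (length-map; length-upTo; length-removeAt′; ++-assoc; map-∘; map-id-local)
open import Data.List.Relation.Binary.Subset.Propositional using (_⊆_)
open import Data.List.Relation.Binary.Subset.Propositional.Properties
  using (⊆-refl; ⊆-trans; ∷⁺ʳ; ∈-∷⁺ʳ)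
open import Data.List.Relation.Unary.All as All using (All; []; _∷_)
import Data.List.Relation.Unary.All.Properties as All
open import Data.List.Relation.Unary.AllPairs using ([]; _∷_)
open import Data.List.Relation.Unary.Any using (Any; here; there; _─_)
open import Data.List.Relation.Unary.Unique.Propositional using (Unique)
import Data.List.Relation.Unary.Unique.Propositional.Properties as Unique
open import Data.Maybe using (Maybe; just; nothing)
open import Data.Nat using (ℕ; suc; _+_; _*_; _≤_; _<_; _>_; _≡ᵇ_; _<ᵇ_; _⊔_; z≤n; s≤s; z<s)
open import Data.Nat.Properties
open import Data.Nat.Tactic.RingSolver using (solve-∀)
open import Data.Product using (_×_; ∃; _,_; proj₁; proj₂)
open import Data.Unit using (tt)
open import Data.Sum using (_⊎_; inj₁; inj₂; [_,_]′)
open import Function using (_∘_)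
open import Function.Bundles using (_⇔_; mk⇔; Equivalence)
open import Relation.Binary.Definitions using (tri<; tri≈; tri>)
open import Relation.Binary.PropositionalEquality
open import Relation.Nullary using (¬_; yes; no)
open import Relation.Nullary.Reflects using (Reflects; ofʸ; ofⁿ; fromEquivalence)

≡ᵇ-reflects-≡ : ∀ m n → Reflects (m ≡ n) (m ≡ᵇ n)
≡ᵇ-reflects-≡ m n = fromEquivalence (≡ᵇ⇒≡ m n) (≡⇒≡ᵇ m n)

unique-++⁻ʳ : ∀ {A : Set} (xs : List A) {ys} → Unique (xs ++ ys) → Unique ys
unique-++⁻ʳ []       uniq       = uniq
unique-++⁻ʳ (_ ∷ xs) (_ ∷ uniq) = unique-++⁻ʳ xs uniq

unique-++-disjoint : ∀ {A : Set} (xs : List A) {ys x} → Unique (xs ++ ys) → x ∈ xs → x ∉ ys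
unique-++-disjoint (_ ∷ xs) (x∉ ∷ _)  (here refl) x∈ys = All.lookup (All.++⁻ʳ xs x∉) x∈ys refl
unique-++-disjoint (_ ∷ xs) (_ ∷ uniq) (there x∈)  = unique-++-disjoint xs uniq x∈

∈-─ : ∀ {A : Set} {x y : A} {ys} (x∈ys : x ∈ ys) → y ∈ ys → y ≢ x → y ∈ (ys ─ x∈ys)
∈-─ (here refl) (here refl) y≢x = ⊥-elim (y≢x refl)
∈-─ (here refl) (there y∈)  _   = y∈
∈-─ (there x∈)  (here refl) _   = here refl
∈-─ (there x∈)  (there y∈)  y≢x = there (∈-─ x∈ y∈ y≢x)

unique-⊆-length : ∀ {A : Set} {xs ys : List A} → Unique xs → xs ⊆ ys → length xs ≤ length ys
unique-⊆-length {xs = []}     _            _     = z≤n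
unique-⊆-length {xs = x ∷ xs} {ys} (x∉ ∷ uniq) xs⊆ys = begin
  suc (length xs)           ≤⟨ s≤s (unique-⊆-length uniq sub) ⟩
  suc (length (ys ─ x∈ys))  ≡⟨ length-removeAt′ ys _ ⟨
  length ys                 ∎
  where
  open ≤-Reasoning
  x∈ys : x ∈ ys
  x∈ys = xs⊆ys (here refl)
  sub : xs ⊆ (ys ─ x∈ys)
  sub y∈ = ∈-─ x∈ys (xs⊆ys (there y∈)) (λ y≡x → All.lookup x∉ y∈ (sym y≡x))

HasCard-map : ∀ {A B : Set} {P : A → Set} {Q : B → Set} (f : A → B) (g : B → A) →
  (∀ {x} → P x → Q (f x)) → (∀ {y} → Q y → P (g y)) →
  (∀ {x} → P x → g (f x) ≡ x) → (∀ {y} → Q y → f (g y) ≡ y) →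
  ∀ {m} → HasCard P m → HasCard Q m
HasCard-map {P = P} {Q} f g P⇒Q Q⇒P gf≗id fg≗id (L , uniq , L⇔P , ∣L∣≡m) =
  map f L , Unique.map⁻ (subst Unique (sym g∘f-on-L) uniq) , (λ y → mk⇔ (to y) (from y)) ,
  trans (length-map f L) ∣L∣≡m
  where
  P-on-L : ∀ {x} → x ∈ L → P x
  P-on-L {x} = Equivalence.to (L⇔P x)
  g∘f-on-L : map g (map f L) ≡ L
  g∘f-on-L = trans (sym (map-∘ L)) (map-id-local (All.tabulate (gf≗id ∘ P-on-L)))
  to : ∀ y → y ∈ map f L → Q y
  to y y∈ with ∈-map⁻ f y∈
  ... | x , x∈L , refl = P⇒Q (P-on-L x∈L)
  from : ∀ y → Q y → y ∈ map f L
  from y Qy = subst (_∈ map f L) (fg≗id Qy) (∈-map⁺ f (Equivalence.from (L⇔P (g y)) (Q⇒P Qy)))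

data LargestBetween (lo hi : ℕ) (xs : List ℕ) : Maybe ℕ → Set where
  none : (∀ {x} → x ∈ xs → ¬ (lo < x × x < hi)) → LargestBetween lo hi xs nothing
  some : ∀ {a} → a ∈ xs → lo < a → a < hi →
         (∀ {x} → x ∈ xs → lo < x → x < hi → x ≤ a) → LargestBetween lo hi xs (just a)

largestBetween-skip : ∀ {lo hi y xs m} → ¬ (lo < y × y < hi) →
  LargestBetween lo hi xs m → LargestBetween lo hi (y ∷ xs) m
largestBetween-skip y∉ (none out) = none λ { (here refl) → y∉ ; (there x∈) → out x∈ }
largestBetween-skip y∉ (some a∈ lo<a a<hi max) = some (there a∈) lo<a a<hi λ
  { (here refl) lo<y y<hi → ⊥-elim (y∉ (lo<y , y<hi)) ; (there x∈) → max x∈ }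

largestBetween-spec : ∀ lo hi xs → LargestBetween lo hi xs (largestBetween lo hi xs)
largestBetween-spec lo hi [] = none λ ()
largestBetween-spec lo hi (y ∷ xs)
  with lo <ᵇ y | <ᵇ-reflects-< lo y | y <ᵇ hi | <ᵇ-reflects-< y hi
     | largestBetween lo hi xs | largestBetween-spec lo hi xs
... | false | ofⁿ lo≮y | _     | _         | _ | rec = largestBetween-skip (lo≮y ∘ proj₁) rec
... | true  | _        | false | ofⁿ y≮hi  | _ | rec = largestBetween-skip (y≮hi ∘ proj₂) rec
... | true | ofʸ lo<y | true | ofʸ y<hi | _ | none out = some (here refl) lo<y y<hi λ
  { (here refl) _ _ → ≤-refl ; (there x∈) lo<x x<hi → ⊥-elim (out x∈ (lo<x , x<hi)) }
... | true | ofʸ lo<y | true | ofʸ y<hi | _ | some {a} a∈ lo<a a<hi max =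
  some (⊔∈ (⊔-sel y a)) (<-≤-trans lo<y (m≤m⊔n y a)) (⊔-lub y<hi a<hi) λ
  { (here refl) _ _ → m≤m⊔n y a ; (there x∈) lo<x x<hi → ≤-trans (max x∈ lo<x x<hi) (m≤n⊔m y a) }
  where
  ⊔∈ : (y ⊔ a ≡ y) ⊎ (y ⊔ a ≡ a) → y ⊔ a ∈ y ∷ xs
  ⊔∈ (inj₁ eq) = here eq
  ⊔∈ (inj₂ eq) = there (subst (_∈ xs) (sym eq) a∈)

LargestBetween-unique : ∀ {lo hi xs m m′} →
  LargestBetween lo hi xs m → LargestBetween lo hi xs m′ → m ≡ m′
LargestBetween-unique (none _) (none _) = refl
LargestBetween-unique (none out) (some a∈ lo<a a<hi _) = ⊥-elim (out a∈ (lo<a , a<hi))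
LargestBetween-unique (some a∈ lo<a a<hi _) (none out) = ⊥-elim (out a∈ (lo<a , a<hi))
LargestBetween-unique (some a∈ lo<a a<hi max) (some b∈ lo<b b<hi max′) =
  cong just (≤-antisym (max′ a∈ lo<a a<hi) (max b∈ lo<b b<hi))

largestBetween-≡ : ∀ {lo hi xs m} → LargestBetween lo hi xs m → largestBetween lo hi xs ≡ m
largestBetween-≡ = LargestBetween-unique (largestBetween-spec _ _ _)

swapVal : ℕ → ℕ → ℕ → ℕ
swapVal a b x = if x ≡ᵇ a then b else (if x ≡ᵇ b then a else x)

swapVal-fst : ∀ a b → swapVal a b a ≡ b
swapVal-fst a b with a ≡ᵇ a | ≡ᵇ-reflects-≡ a a
... | true  | _ = refl
... | false | ofⁿ a≢a = ⊥-elim (a≢a refl)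

swapVal-snd : ∀ a b → swapVal a b b ≡ a
swapVal-snd a b with b ≡ᵇ a | ≡ᵇ-reflects-≡ b a
... | true  | ofʸ b≡a = b≡a
... | false | _ with b ≡ᵇ b | ≡ᵇ-reflects-≡ b b
...   | true  | _ = refl
...   | false | ofⁿ b≢b = ⊥-elim (b≢b refl)

swapVal-other : ∀ a b {x} → x ≢ a → x ≢ b → swapVal a b x ≡ x
swapVal-other a b {x} x≢a x≢b with x ≡ᵇ a | ≡ᵇ-reflects-≡ x a
... | true  | ofʸ x≡a = ⊥-elim (x≢a x≡a)
... | false | _ with x ≡ᵇ b | ≡ᵇ-reflects-≡ x b
...   | true  | ofʸ x≡b = ⊥-elim (x≢b x≡b)
...   | false | _ = refl

swapVal-involutive : ∀ a b x → swapVal a b (swapVal a b x) ≡ x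
swapVal-involutive a b x with x ≟ a | x ≟ b
... | yes refl | _ = trans (cong (swapVal a b) (swapVal-fst a b)) (swapVal-snd a b)
... | no _ | yes refl = trans (cong (swapVal a b) (swapVal-snd a b)) (swapVal-fst a b)
... | no x≢a | no x≢b = trans (cong (swapVal a b) (swapVal-other a b x≢a x≢b)) (swapVal-other a b x≢a x≢b)

swapVal-injective : ∀ a b {x y} → swapVal a b x ≡ swapVal a b y → x ≡ y
swapVal-injective a b {x} {y} eq = begin
  x                             ≡⟨ swapVal-involutive a b x ⟨
  swapVal a b (swapVal a b x)   ≡⟨ cong (swapVal a b) eq ⟩
  swapVal a b (swapVal a b y)   ≡⟨ swapVal-involutive a b y ⟩
  y                             ∎
  where open ≡-Reasoning

swapVals-involutive : ∀ a b u → swapVals a b (swapVals a b u) ≡ u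
swapVals-involutive a b []      = refl
swapVals-involutive a b (x ∷ u) = cong₂ _∷_ (swapVal-involutive a b x) (swapVals-involutive a b u)

swapVal-∈ : ∀ {a b u x} → a ∈ u → b ∈ u → x ∈ u → swapVal a b x ∈ u
swapVal-∈ {a} {b} {u} {x} a∈ b∈ x∈ with x ≟ a | x ≟ b
... | yes refl | _ = subst (_∈ u) (sym (swapVal-fst a b)) b∈
... | no _ | yes refl = subst (_∈ u) (sym (swapVal-snd a b)) a∈
... | no x≢a | no x≢b = subst (_∈ u) (sym (swapVal-other a b x≢a x≢b)) x∈

swapVals-⊆ : ∀ {a b u} → a ∈ u → b ∈ u → swapVals a b u ⊆ u
swapVals-⊆ a∈ b∈ x∈ with ∈-map⁻ _ x∈
... | y , y∈ , refl = swapVal-∈ a∈ b∈ y∈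

swapVals-⊇ : ∀ {a b u} → a ∈ u → b ∈ u → u ⊆ swapVals a b u
swapVals-⊇ {a} {b} {u} a∈ b∈ {x} x∈ =
  subst (_∈ swapVals a b u) (swapVal-involutive a b x) (∈-map⁺ (swapVal a b) (swapVal-∈ a∈ b∈ x∈))

StrictlyMonotoneOn : List ℕ → (ℕ → ℕ) → Set
StrictlyMonotoneOn u g = ∀ {x y} → x ∈ u → y ∈ u → x < y → g x < g y

mutual
  map-downUp : ∀ {g u} → StrictlyMonotoneOn u g → DownUp u → DownUp (map g u)
  map-downUp mono du[]          = du[]
  map-downUp mono du[ x ]       = du[ _ ]
  map-downUp mono (du∷ x>y ud)  =
    du∷ (mono (there (here refl)) (here refl) x>y) (map-upDown (λ x∈ y∈ → mono (there x∈) (there y∈)) ud)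

  map-upDown : ∀ {g u} → StrictlyMonotoneOn u g → UpDown u → UpDown (map g u)
  map-upDown mono ud[]          = ud[]
  map-upDown mono ud[ x ]       = ud[ _ ]
  map-upDown mono (ud∷ x<y du)  =
    ud∷ (mono (here refl) (there (here refl)) x<y) (map-downUp (λ x∈ y∈ → mono (there x∈) (there y∈)) du)

Endpoint : ℕ → ℕ → ℕ → Set
Endpoint c d z = z ≡ c ⊎ z ≡ d

endpoint? : ∀ c d z → Endpoint c d z ⊎ (z ≢ c × z ≢ d)
endpoint? c d z with z ≟ c | z ≟ d
... | yes z≡c | _       = inj₁ (inj₁ z≡c)
... | no _    | yes z≡d = inj₁ (inj₂ z≡d)
... | no z≢c  | no z≢d  = inj₂ (z≢c , z≢d)

endpoint-bounds : ∀ {c d z} → c < d → Endpoint c d z → c ≤ z × z ≤ d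
endpoint-bounds c<d (inj₁ refl) = ≤-refl , <⇒≤ c<d
endpoint-bounds c<d (inj₂ refl) = <⇒≤ c<d , ≤-refl

swapVal-endpoint : ∀ {c d z} → Endpoint c d z → Endpoint c d (swapVal d c z)
swapVal-endpoint {c} {d} (inj₁ refl) = inj₂ (swapVal-snd d c)
swapVal-endpoint {c} {d} (inj₂ refl) = inj₁ (swapVal-fst d c)

swapVal-monotone : ∀ {c d u} → c < d → (∀ {z} → z ∈ u → ¬ (c < z × z < d)) → c ∉ u ⊎ d ∉ u →
  StrictlyMonotoneOn u (swapVal d c)
swapVal-monotone {c} {d} {u} c<d gap one-missing {x} {y} x∈ y∈ x<y
  with endpoint? c d x | endpoint? c d y
... | inj₁ (inj₁ refl) | inj₁ (inj₁ refl) = ⊥-elim (<-irrefl refl x<y)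
... | inj₁ (inj₁ refl) | inj₁ (inj₂ refl) = ⊥-elim ([ (λ c∉ → c∉ x∈) , (λ d∉ → d∉ y∈) ]′ one-missing)
... | inj₁ (inj₂ refl) | inj₁ y-end = ⊥-elim (<⇒≱ x<y (proj₂ (endpoint-bounds c<d y-end)))
... | inj₁ x-end | inj₂ (y≢c , y≢d) = begin-strict
  swapVal d c x ≤⟨ proj₂ (endpoint-bounds c<d (swapVal-endpoint x-end)) ⟩
  d             <⟨ above ⟩
  y             ≡⟨ swapVal-other d c y≢d y≢c ⟨
  swapVal d c y ∎
  where
  open ≤-Reasoning
  above : d < y
  above with <-cmp y d
  ... | tri< y<d _ _ = ⊥-elim (gap y∈ (≤-<-trans (proj₁ (endpoint-bounds c<d x-end)) x<y , y<d))
  ... | tri≈ _ y≡d _ = ⊥-elim (y≢d y≡d)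
  ... | tri> _ _ d<y = d<y
... | inj₂ (x≢c , x≢d) | inj₁ y-end = begin-strict
  swapVal d c x ≡⟨ swapVal-other d c x≢d x≢c ⟩
  x             <⟨ below ⟩
  c             ≤⟨ proj₁ (endpoint-bounds c<d (swapVal-endpoint y-end)) ⟩
  swapVal d c y ∎
  where
  open ≤-Reasoning
  below : x < c
  below with <-cmp x c
  ... | tri< x<c _ _ = x<c
  ... | tri≈ _ x≡c _ = ⊥-elim (x≢c x≡c)
  ... | tri> _ _ c<x = ⊥-elim (gap x∈ (c<x , <-≤-trans x<y (proj₂ (endpoint-bounds c<d y-end))))
... | inj₂ (x≢c , x≢d) | inj₂ (y≢c , y≢d) =
  subst₂ _<_ (sym (swapVal-other d c x≢d x≢c)) (sym (swapVal-other d c y≢d y≢c)) x<y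

swapVals-downUp : ∀ {c d x y rest} → c < d → y < c → Endpoint c d x → Unique (x ∷ y ∷ rest) →
  (∀ {z} → z ∈ x ∷ y ∷ rest → ¬ (c < z × z < d)) →
  DownUp (x ∷ y ∷ rest) → DownUp (swapVals d c (x ∷ y ∷ rest))
swapVals-downUp {c} {d} {x} {y} c<d y<c x-end (x∉ ∷ _) gap (du∷ _ ud) =
  du∷ head-descent (map-upDown (swapVal-monotone c<d (gap ∘ there) (one-missing x-end)) ud)
  where
  y-fixed : swapVal d c y ≡ y
  y-fixed = swapVal-other d c (λ y≡d → <-irrefl y≡d (<-trans y<c c<d)) (λ y≡c → <-irrefl y≡c y<c)
  head-descent : swapVal d c x > swapVal d c y
  head-descent = subst (_< swapVal d c x) (sym y-fixed)
    (<-≤-trans y<c (proj₁ (endpoint-bounds c<d (swapVal-endpoint x-end))))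
  one-missing : Endpoint c d x → c ∉ y ∷ _ ⊎ d ∉ y ∷ _
  one-missing (inj₁ refl) = inj₁ (λ c∈ → All.lookup x∉ c∈ refl)
  one-missing (inj₂ refl) = inj₂ (λ d∈ → All.lookup x∉ d∈ refl)

-- One iteration of the loop

InRange : ℕ → ℕ → Set
InRange n x = 1 ≤ x × x ≤ n

record DownUpWord (n : ℕ) (w : List ℕ) : Set where
  constructor downUpWord
  field
    unique  : Unique w
    downUp  : DownUp w
    inRange : All (InRange n) w

downUp-descent : ∀ {x y r} → DownUp (x ∷ y ∷ r) → y < x
downUp-descent (du∷ y<x _) = y<x

lead : List ℕ → ℕ
lead []      = 0
lead (x ∷ _) = x

lead≤ : ∀ {n w} → All (InRange n) w → lead w ≤ n
lead≤ []              = z≤n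
lead≤ ((_ , x≤n) ∷ _) = x≤n

measure : ℕ → List ℕ → ℕ
measure n w = lead w + length w * n

dominoStep-downUpWord : ∀ {n p₁ p₂ rest a} → DownUpWord n (p₁ ∷ p₂ ∷ rest) →
  LargestBetween p₂ p₁ (p₁ ∷ p₂ ∷ rest) (just a) → DownUpWord n (swapVals p₁ a (p₁ ∷ p₂ ∷ rest))
dominoStep-downUpWord {n} {p₁} {p₂} {rest} {a} (downUpWord uniq du inR) (some a∈ p₂<a a<p₁ max) =
  downUpWord (Unique.map⁺ (swapVal-injective p₁ a) uniq)
             (swapVals-downUp a<p₁ p₂<a (inj₂ refl) uniq gap du)
             (All.tabulate (All.lookup inR ∘ swapVals-⊆ (here refl) a∈))
  where
  gap : ∀ {z} → z ∈ p₁ ∷ p₂ ∷ rest → ¬ (a < z × z < p₁)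
  gap z∈ (a<z , z<p₁) = <⇒≱ a<z (max z∈ (<-trans p₂<a a<z) z<p₁)

dominoStep-measure : ∀ n {p₁ a} w → a < p₁ → measure n (swapVals p₁ a (p₁ ∷ w)) < measure n (p₁ ∷ w)
dominoStep-measure n {p₁} {a} w a<p₁
  rewrite swapVal-fst p₁ a | length-map (swapVal p₁ a) w = +-monoˡ-< (suc (length w) * n) a<p₁

starStep-downUpWord : ∀ {n p₁ p₂ rest} → DownUpWord n (p₁ ∷ p₂ ∷ rest) → DownUpWord n rest
starStep-downUpWord (downUpWord (_ ∷ _ ∷ uniq) (du∷ _ ud) (_ ∷ _ ∷ inR)) = downUpWord uniq (tail ud) inR
  where
  tail : ∀ {p rest} → UpDown (p ∷ rest) → DownUp rest
  tail ud[ _ ]   = du[]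
  tail (ud∷ _ du) = du

starStep-measure : ∀ {n p₁ p₂ rest} → DownUpWord n (p₁ ∷ p₂ ∷ rest) →
  measure n rest < measure n (p₁ ∷ p₂ ∷ rest)
starStep-measure {n} {p₁} {p₂} {rest} (downUpWord _ _ ((1≤p₁ , _) ∷ _ ∷ inR)) = begin-strict
  lead rest + L           ≤⟨ +-monoˡ-≤ L (lead≤ inR) ⟩
  n + L                   <⟨ s≤s (m≤n+m (n + L) n) ⟩
  suc (n + (n + L))       ≤⟨ +-monoˡ-≤ (n + (n + L)) 1≤p₁ ⟩
  p₁ + (n + (n + L))      ∎
  where
  open ≤-Reasoning
  L : ℕ
  L = length rest * n

Fuelled : ℕ → ℕ → List ℕ → Set
Fuelled n f w = DownUpWord n w × measure n w < f

dominoStep-fuelled : ∀ {n f p₁ p₂ rest a} → Fuelled n (suc f) (p₁ ∷ p₂ ∷ rest) →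
  LargestBetween p₂ p₁ (p₁ ∷ p₂ ∷ rest) (just a) → Fuelled n f (swapVals p₁ a (p₁ ∷ p₂ ∷ rest))
dominoStep-fuelled {n} {p₂ = p₂} {rest} (valid , s≤s μ≤f) step@(some _ _ a<p₁ _) =
  dominoStep-downUpWord valid step , <-≤-trans (dominoStep-measure n (p₂ ∷ rest) a<p₁) μ≤f

starStep-fuelled : ∀ {n f p₁ p₂ rest} → Fuelled n (suc f) (p₁ ∷ p₂ ∷ rest) → Fuelled n f rest
starStep-fuelled (valid , s≤s μ≤f) = starStep-downUpWord valid , <-≤-trans (starStep-measure valid) μ≤f

entries-star-diag : ∀ a → entries (star a a) ≡ a ∷ []
entries-star-diag a with a ≡ᵇ a | ≡ᵇ-reflects-≡ a a
... | true  | _ = refl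
... | false | ofⁿ a≢a = ⊥-elim (a≢a refl)

entries-star : ∀ {j i} → j ≢ i → entries (star j i) ≡ j ∷ i ∷ []
entries-star {j} {i} j≢i with j ≡ᵇ i | ≡ᵇ-reflects-≡ j i
... | true  | ofʸ j≡i = ⊥-elim (j≢i j≡i)
... | false | _ = refl

starEntries-star : ∀ {j i} Δ → j ≢ i → starEntries (star j i ∷ Δ) ≡ j ∷ i ∷ starEntries Δ
starEntries-star Δ j≢i = cong (_++ starEntries Δ) (entries-star j≢i)

Leads : List ℕ → List Domino → Set
Leads []      Δ = Δ ≡ []
Leads (x ∷ _) Δ = NextFirst≡ x Δ

EntriesIn : List ℕ → List Domino → Set
EntriesIn w = All (λ d → entries d ⊆ w)

entriesIn-mono : ∀ {w v} → w ⊆ v → ∀ {Δ} → EntriesIn w Δ → EntriesIn v Δ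
entriesIn-mono w⊆v []            = []
entriesIn-mono w⊆v (d⊆w ∷ Δ⊆w) = ⊆-trans d⊆w w⊆v ∷ entriesIn-mono w⊆v Δ⊆w

record CodeShape (w : List ℕ) (Δ : List Domino) : Set where
  field
    leads        : Leads w Δ
    entries⊆     : EntriesIn w Δ
    stars⊆       : starEntries Δ ⊆ w
    stars⊇       : w ⊆ starEntries Δ
    stars-unique : Unique (starEntries Δ)

single-shape : ∀ a → CodeShape (a ∷ []) (star a a ∷ [])
single-shape a = record
  { leads        = refl
  ; entries⊆     = subst (_⊆ a ∷ []) (sym (entries-star-diag a)) ⊆-refl ∷ []
  ; stars⊆       = subst (_⊆ a ∷ []) (sym stars) ⊆-refl
  ; stars⊇       = subst (a ∷ [] ⊆_) (sym stars) ⊆-refl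
  ; stars-unique = subst Unique (sym stars) ([] ∷ [])
  }
  where
  stars : starEntries (star a a ∷ []) ≡ a ∷ []
  stars = cong (_++ []) (entries-star-diag a)

dominoStep-shape : ∀ {p₁ p₂ rest a Δ} → a ∈ p₁ ∷ p₂ ∷ rest →
  CodeShape (swapVals p₁ a (p₁ ∷ p₂ ∷ rest)) Δ → CodeShape (p₁ ∷ p₂ ∷ rest) (dom p₁ a ∷ Δ)
dominoStep-shape {p₁} {p₂} {rest} {a} a∈ shape = record
  { leads        = refl
  ; entries⊆     = ∈-∷⁺ʳ (here refl) (∈-∷⁺ʳ a∈ λ ()) ∷ entriesIn-mono w′⊆w entries⊆
  ; stars⊆       = ⊆-trans stars⊆ w′⊆w
  ; stars⊇       = ⊆-trans (swapVals-⊇ (here refl) a∈) stars⊇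
  ; stars-unique = stars-unique
  }
  where
  open CodeShape shape
  w′⊆w : swapVals p₁ a (p₁ ∷ p₂ ∷ rest) ⊆ p₁ ∷ p₂ ∷ rest
  w′⊆w = swapVals-⊆ (here refl) a∈

starStep-shape : ∀ {p₁ p₂ rest Δ} → p₂ < p₁ → Unique (p₁ ∷ p₂ ∷ rest) →
  CodeShape rest Δ → CodeShape (p₁ ∷ p₂ ∷ rest) (star p₁ p₂ ∷ Δ)
starStep-shape {p₁} {p₂} {rest} {Δ} p₂<p₁ (p₁∉ ∷ p₂∉ ∷ _) shape = record
  { leads        = refl
  ; entries⊆     = subst (_⊆ p₁ ∷ p₂ ∷ rest) (sym (entries-star p₁≢p₂)) (∷⁺ʳ p₁ (∷⁺ʳ p₂ (λ ())))
                   ∷ entriesIn-mono (there ∘ there) entries⊆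
  ; stars⊆       = subst (_⊆ p₁ ∷ p₂ ∷ rest) (sym stars) (∷⁺ʳ p₁ (∷⁺ʳ p₂ stars⊆))
  ; stars⊇       = subst (p₁ ∷ p₂ ∷ rest ⊆_) (sym stars) (∷⁺ʳ p₁ (∷⁺ʳ p₂ stars⊇))
  ; stars-unique = subst Unique (sym stars)
      ( (p₁≢p₂ ∷ All.tabulate (λ x∈ p₁≡x → All.lookup p₁∉ (there (stars⊆ x∈)) p₁≡x))
      ∷ All.tabulate (λ x∈ p₂≡x → All.lookup p₂∉ (stars⊆ x∈) p₂≡x)
      ∷ stars-unique )
  }
  where
  open CodeShape shape
  p₁≢p₂ : p₁ ≢ p₂
  p₁≢p₂ = >⇒≢ p₂<p₁
  stars : starEntries (star p₁ p₂ ∷ Δ) ≡ p₁ ∷ p₂ ∷ starEntries Δ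
  stars = starEntries-star Δ p₁≢p₂

ψ-go-shape : ∀ {n} f w → Fuelled n f w → CodeShape w (ψ-go f w)
ψ-go-shape f [] _ = record
  { leads = refl ; entries⊆ = [] ; stars⊆ = λ () ; stars⊇ = λ () ; stars-unique = [] }
ψ-go-shape f (a ∷ []) _ = single-shape a
ψ-go-shape (suc f) w@(p₁ ∷ p₂ ∷ rest) fuelled@(downUpWord uniq du _ , _)
  with largestBetween p₂ p₁ w | largestBetween-spec p₂ p₁ w
... | just a  | step@(some a∈ _ _ _) = dominoStep-shape a∈ (ψ-go-shape f _ (dominoStep-fuelled fuelled step))
... | nothing | none _ = starStep-shape (downUp-descent du) uniq (ψ-go-shape f rest (starStep-fuelled fuelled))

-- The encoding conditions

firstEntry∈entries : ∀ d → firstEntry d ∈ entries d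
firstEntry∈entries (dom j i)  = here refl
firstEntry∈entries (star j i) with j ≡ᵇ i
... | true  = here refl
... | false = here refl

nextFirst≡-any : ∀ {x} Δ → NextFirst≡ x Δ → Any (λ d → x ∈ entries d) Δ
nextFirst≡-any (d ∷ _) refl = here (firstEntry∈entries d)

starEntries-any : ∀ {x} Δ → x ∈ starEntries Δ → Any (λ d → x ∈ entries d) Δ
starEntries-any (dom j i ∷ Δ) x∈ = there (starEntries-any Δ x∈)
starEntries-any (star j i ∷ Δ) x∈ with ∈-++⁻ (entries (star j i)) x∈
... | inj₁ x∈d = here x∈d
... | inj₂ x∈Δ = there (starEntries-any Δ x∈Δ)

starEntries-++ : ∀ E F → starEntries (E ++ F) ≡ starEntries E ++ starEntries F
starEntries-++ []             F = refl
starEntries-++ (dom j i ∷ E)  F = starEntries-++ E F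
starEntries-++ (star j i ∷ E) F =
  trans (cong (entries (star j i) ++_) (starEntries-++ E F)) (sym (++-assoc (entries (star j i)) _ _))

starEntries-snoc⁺ˡ : ∀ {x} E d → x ∈ starEntries E → x ∈ starEntries (E ++ d ∷ [])
starEntries-snoc⁺ˡ E d x∈ = subst (_ ∈_) (sym (starEntries-++ E (d ∷ []))) (∈-++⁺ˡ x∈)

starEntries-snoc⁺ʳ : ∀ {x} E d → x ∈ starEntries (d ∷ []) → x ∈ starEntries (E ++ d ∷ [])
starEntries-snoc⁺ʳ E d x∈ = subst (_ ∈_) (sym (starEntries-++ E (d ∷ []))) (∈-++⁺ʳ (starEntries E) x∈)

Covered : ℕ → List Domino → List ℕ → Set
Covered n E w = ∀ {x} → InRange n x → x ∈ w ⊎ x ∈ starEntries E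

-- Makes the last, unpaired letter n, so that the code ends with (n)*.
HoldsMax : ℕ → List ℕ → Set
HoldsMax n w = w ≡ [] ⊎ n ∈ w

dominoStep-letter : ∀ {n E p₁ p₂ rest a Δ} → DownUpWord n (p₁ ∷ p₂ ∷ rest) →
  LargestBetween p₂ p₁ (p₁ ∷ p₂ ∷ rest) (just a) → Covered n E (p₁ ∷ p₂ ∷ rest) →
  CodeShape (swapVals p₁ a (p₁ ∷ p₂ ∷ rest)) Δ →
  DominoOn n (dom p₁ a) × LetterCond E (dom p₁ a) Δ
dominoStep-letter {n} {E} {p₁} {a = a} {Δ} valid (some a∈ p₂<a a<p₁ max) covered shape =
  (1≤a , a<p₁ , p₁≤n) , nextFirst≡-any Δ next-a , starEntries-any Δ p₁∈stars , next-a , between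
  where
  open CodeShape shape
  p₁≤n : p₁ ≤ n
  p₁≤n = proj₂ (All.lookup (DownUpWord.inRange valid) (here refl))
  1≤a : 1 ≤ a
  1≤a = proj₁ (All.lookup (DownUpWord.inRange valid) a∈)
  next-a : NextFirst≡ a Δ
  next-a = subst (λ x → NextFirst≡ x Δ) (swapVal-fst p₁ a) leads
  p₁∈stars : p₁ ∈ starEntries Δ
  p₁∈stars = stars⊇ (swapVals-⊇ (here refl) a∈ (here refl))
  between : ∀ x → a < x → x < p₁ → x ∈ starEntries E
  between x a<x x<p₁ with covered (≤-trans 1≤a (<⇒≤ a<x) , ≤-trans (<⇒≤ x<p₁) p₁≤n)
  ... | inj₁ x∈w = ⊥-elim (<⇒≱ a<x (max x∈w (<-trans p₂<a a<x) x<p₁))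
  ... | inj₂ x∈E = x∈E

starStep-letter : ∀ {n E p₁ p₂ rest Δ} → DownUpWord n (p₁ ∷ p₂ ∷ rest) →
  LargestBetween p₂ p₁ (p₁ ∷ p₂ ∷ rest) nothing → CodeShape rest Δ →
  DominoOn n (star p₁ p₂) × LetterCond E (star p₁ p₂) Δ
starStep-letter {n} {E} {p₁} {p₂} {rest} {Δ}
  (downUpWord _ (du∷ p₂<p₁ ud) ((_ , p₁≤n) ∷ (1≤p₂ , _) ∷ _)) (none out) shape =
  inj₁ (1≤p₂ , p₂<p₁ , p₁≤n) , next-above rest ud leads , outside entries⊆
  where
  open CodeShape shape
  next-above : ∀ r {Δ′} → UpDown (p₂ ∷ r) → Leads r Δ′ → NextFirst> p₂ Δ′
  next-above []                 _             refl = tt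
  next-above (_ ∷ _) {_ ∷ _}    (ud∷ p₂<p₃ _) refl = p₂<p₃
  outside : ∀ {Δ′} → EntriesIn rest Δ′ → All (λ d → All (λ x → ¬ (p₂ < x × x < p₁)) (entries d)) Δ′
  outside []            = []
  outside (d⊆ ∷ Δ′⊆) = All.tabulate (out ∘ there ∘ there ∘ d⊆) ∷ outside Δ′⊆

starStep-holdsMax : ∀ {n p₁ p₂ rest} → DownUpWord n (p₁ ∷ p₂ ∷ rest) →
  LargestBetween p₂ p₁ (p₁ ∷ p₂ ∷ rest) nothing → HoldsMax n (p₁ ∷ p₂ ∷ rest) → HoldsMax n rest
starStep-holdsMax {rest = []} _ _ _ = inj₁ refl
starStep-holdsMax (downUpWord (p₁∉ ∷ _) (du∷ p₂<p₁ (ud∷ p₂<p₃ _)) (_ ∷ _ ∷ (_ , p₃≤n) ∷ _)) (none out)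
  (inj₂ (here refl)) =
  ⊥-elim (out (there (there (here refl)))
    (p₂<p₃ , ≤∧≢⇒< p₃≤n (λ p₃≡n → All.lookup p₁∉ (there (here (sym p₃≡n))) refl)))
starStep-holdsMax (downUpWord _ (du∷ p₂<p₁ _) ((_ , p₁≤n) ∷ _)) _ (inj₂ (there (here refl))) =
  ⊥-elim (<-irrefl refl (<-≤-trans p₂<p₁ p₁≤n))
starStep-holdsMax _ _ (inj₂ (there (there n∈rest))) = inj₂ n∈rest

dominoStep-holdsMax : ∀ {n p₁ a w} → p₁ ∈ w → a ∈ w → HoldsMax n w → HoldsMax n (swapVals p₁ a w)
dominoStep-holdsMax p₁∈ a∈ (inj₁ refl) = inj₁ refl
dominoStep-holdsMax p₁∈ a∈ (inj₂ n∈w)  = inj₂ (swapVals-⊇ p₁∈ a∈ n∈w)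

dominoStep-covered : ∀ {n E p₁ a w} → p₁ ∈ w → a ∈ w → Covered n E w →
  Covered n (E ++ dom p₁ a ∷ []) (swapVals p₁ a w)
dominoStep-covered {E = E} p₁∈ a∈ covered x∈[n] with covered x∈[n]
... | inj₁ x∈w = inj₁ (swapVals-⊇ p₁∈ a∈ x∈w)
... | inj₂ x∈E = inj₂ (starEntries-snoc⁺ˡ E _ x∈E)

starEntries-snoc-star : ∀ {x j i} E → j ≢ i → x ∈ j ∷ i ∷ [] → x ∈ starEntries (E ++ star j i ∷ [])
starEntries-snoc-star E j≢i x∈ = starEntries-snoc⁺ʳ E _ (subst (_ ∈_) (sym (starEntries-star [] j≢i)) x∈)

starStep-covered : ∀ {n E p₁ p₂ rest} → p₁ ≢ p₂ → Covered n E (p₁ ∷ p₂ ∷ rest) →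
  Covered n (E ++ star p₁ p₂ ∷ []) rest
starStep-covered {E = E} p₁≢p₂ covered x∈[n] with covered x∈[n]
... | inj₁ (here refl)            = inj₂ (starEntries-snoc-star E p₁≢p₂ (here refl))
... | inj₁ (there (here refl))    = inj₂ (starEntries-snoc-star E p₁≢p₂ (there (here refl)))
... | inj₁ (there (there x∈rest)) = inj₁ x∈rest
... | inj₂ x∈E                    = inj₂ (starEntries-snoc⁺ˡ E _ x∈E)

ψ-go-encodes : ∀ {n} f w E → Fuelled n f w → HoldsMax n w → Covered n E w →
  All (DominoOn n) (ψ-go f w) × EncCond E (ψ-go f w)
ψ-go-encodes f [] E _ _ _ = [] , tt
ψ-go-encodes f (a ∷ []) E _ (inj₂ (here refl)) _ = inj₂ (refl , refl) ∷ [] , (tt , []) , tt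
ψ-go-encodes {n} (suc f) w@(p₁ ∷ p₂ ∷ rest) E fuelled@(valid , _) holdsMax covered
  with largestBetween p₂ p₁ w | largestBetween-spec p₂ p₁ w
... | just a | step@(some a∈ _ _ _) =
  proj₁ on-letter ∷ proj₁ encoded , proj₂ on-letter , proj₂ encoded
  where
  fuelled′ : Fuelled n f (swapVals p₁ a w)
  fuelled′ = dominoStep-fuelled fuelled step
  on-letter : DominoOn n (dom p₁ a) × LetterCond E (dom p₁ a) (ψ-go f (swapVals p₁ a w))
  on-letter = dominoStep-letter {E = E} valid step covered (ψ-go-shape f _ fuelled′)
  encoded : All (DominoOn n) (ψ-go f (swapVals p₁ a w)) ×
            EncCond (E ++ dom p₁ a ∷ []) (ψ-go f (swapVals p₁ a w))
  encoded = ψ-go-encodes f _ _ fuelled′ (dominoStep-holdsMax (here refl) a∈ holdsMax)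
                                        (dominoStep-covered {E = E} (here refl) a∈ covered)
... | nothing | step@(none _) =
  proj₁ on-letter ∷ proj₁ encoded , proj₂ on-letter , proj₂ encoded
  where
  fuelled′ : Fuelled n f rest
  fuelled′ = starStep-fuelled fuelled
  on-letter : DominoOn n (star p₁ p₂) × LetterCond E (star p₁ p₂) (ψ-go f rest)
  on-letter = starStep-letter {E = E} valid step (ψ-go-shape f rest fuelled′)
  encoded : All (DominoOn n) (ψ-go f rest) × EncCond (E ++ star p₁ p₂ ∷ []) (ψ-go f rest)
  encoded = ψ-go-encodes f rest _ fuelled′ (starStep-holdsMax valid step holdsMax)
              (starStep-covered {E = E} (>⇒≢ (downUp-descent (DownUpWord.downUp valid))) covered)

-- Decoding

decode : List Domino → List ℕ
decode []             = []
decode (dom j i ∷ Δ)  = swapVals j i (decode Δ)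
decode (star j i ∷ Δ) = entries (star j i) ++ decode Δ

decode-ψ-go : ∀ {n} f w → Fuelled n f w → decode (ψ-go f w) ≡ w
decode-ψ-go f [] _ = refl
decode-ψ-go f (a ∷ []) _ = cong (_++ []) (entries-star-diag a)
decode-ψ-go (suc f) w@(p₁ ∷ p₂ ∷ rest) fuelled@(valid , _)
  with largestBetween p₂ p₁ w | largestBetween-spec p₂ p₁ w
... | just a | step@(some _ _ _ _) = begin
  swapVals p₁ a (decode (ψ-go f (swapVals p₁ a w)))
    ≡⟨ cong (swapVals p₁ a) (decode-ψ-go f _ (dominoStep-fuelled fuelled step)) ⟩
  swapVals p₁ a (swapVals p₁ a w)
    ≡⟨ swapVals-involutive p₁ a w ⟩
  w ∎
  where open ≡-Reasoning
... | nothing | none _ = begin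
  entries (star p₁ p₂) ++ decode (ψ-go f rest)
    ≡⟨ cong₂ _++_ (entries-star p₁≢p₂) (decode-ψ-go f rest (starStep-fuelled fuelled)) ⟩
  p₁ ∷ p₂ ∷ rest ∎
  where
  open ≡-Reasoning
  p₁≢p₂ : p₁ ≢ p₂
  p₁≢p₂ = >⇒≢ (downUp-descent (DownUpWord.downUp valid))

record Encodes (n : ℕ) (w : List ℕ) (Δ : List Domino) : Set where
  field
    valid    : DownUpWord n w
    computes : ∀ f → measure n w < f → ψ-go f w ≡ Δ

encodes-shape : ∀ {n w Δ} → Encodes n w Δ → CodeShape w Δ
encodes-shape {n} {w} encodes =
  subst (CodeShape w) (computes (suc (measure n w)) ≤-refl) (ψ-go-shape _ w (valid , ≤-refl))
  where open Encodes encodes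

ψ-go-domino : ∀ {f p₁ p₂ rest a} → LargestBetween p₂ p₁ (p₁ ∷ p₂ ∷ rest) (just a) →
  ψ-go (suc f) (p₁ ∷ p₂ ∷ rest) ≡ dom p₁ a ∷ ψ-go f (swapVals p₁ a (p₁ ∷ p₂ ∷ rest))
ψ-go-domino step rewrite largestBetween-≡ step = refl

ψ-go-star : ∀ {f p₁ p₂ rest} → LargestBetween p₂ p₁ (p₁ ∷ p₂ ∷ rest) nothing →
  ψ-go (suc f) (p₁ ∷ p₂ ∷ rest) ≡ star p₁ p₂ ∷ ψ-go f rest
ψ-go-star step rewrite largestBetween-≡ step = refl

nextFirst≡-unique : ∀ {x y} Δ → NextFirst≡ x Δ → NextFirst≡ y Δ → x ≡ y
nextFirst≡-unique (_ ∷ _) refl refl = refl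

Any-entries-⊆ : ∀ {x w Δ} → EntriesIn w Δ → Any (λ d → x ∈ entries d) Δ → x ∈ w
Any-entries-⊆ (d⊆w ∷ _) (here x∈d)  = d⊆w x∈d
Any-entries-⊆ (_ ∷ Δ⊆w) (there x∈Δ) = Any-entries-⊆ Δ⊆w x∈Δ

Avoids : ℕ → ℕ → List Domino → Set
Avoids i j = All (λ d → All (λ x → ¬ (i < x × x < j)) (entries d))

avoids-lookup : ∀ {i j z Δ} → Avoids i j Δ → Any (λ d → z ∈ entries d) Δ → ¬ (i < z × z < j)
avoids-lookup (out ∷ _)  (here z∈d)  = All.lookup out z∈d
avoids-lookup (_ ∷ outs) (there z∈Δ) = avoids-lookup outs z∈Δ

starPrefix-encodes : ∀ {n j i w Δ} → Encodes n w Δ → 1 ≤ i → i < j → j ≤ n →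
  Unique (j ∷ i ∷ starEntries Δ) → NextFirst> i Δ → Avoids i j Δ → Encodes n (j ∷ i ∷ w) (star j i ∷ Δ)
starPrefix-encodes {n} {j} {i} {w} {Δ} encodes 1≤i i<j j≤n ((_ ∷ j∉) ∷ i∉ ∷ _) above outside = record
  { valid    = valid′
  ; computes = λ { (suc f) (s≤s μ≤f) → begin
      ψ-go (suc f) (j ∷ i ∷ w)  ≡⟨ ψ-go-star (none gap) ⟩
      star j i ∷ ψ-go f w       ≡⟨ cong (star j i ∷_) (computes f (<-≤-trans (starStep-measure valid′) μ≤f)) ⟩
      star j i ∷ Δ              ∎ }
  }
  where
  open ≡-Reasoning
  open Encodes encodes
  open CodeShape (encodes-shape encodes)
  ascent : ∀ w′ {Δ′} → DownUp w′ → NextFirst> i Δ′ → Leads w′ Δ′ → UpDown (i ∷ w′)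
  ascent []              _  _   _    = ud[ i ]
  ascent (_ ∷ _) {_ ∷ _} du i<x refl = ud∷ i<x du
  valid′ : DownUpWord n (j ∷ i ∷ w)
  valid′ = downUpWord
    ( (>⇒≢ i<j ∷ All.tabulate (λ x∈w j≡x → All.lookup j∉ (stars⊇ x∈w) j≡x))
    ∷ All.tabulate (λ x∈w i≡x → All.lookup i∉ (stars⊇ x∈w) i≡x)
    ∷ DownUpWord.unique valid )
    (du∷ i<j (ascent w (DownUpWord.downUp valid) above leads))
    ((≤-trans 1≤i (<⇒≤ i<j) , j≤n) ∷ (1≤i , ≤-trans (<⇒≤ i<j) j≤n) ∷ DownUpWord.inRange valid)
  gap : ∀ {z} → z ∈ j ∷ i ∷ w → ¬ (i < z × z < j)
  gap (here refl)         (_ , z<j) = <-irrefl refl z<j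
  gap (there (here refl)) (i<z , _) = <-irrefl refl i<z
  gap (there (there z∈w))           = avoids-lookup outside (starEntries-any Δ (stars⊇ z∈w))

-- The first letter of w must be i, and j sits further right; exchanging
-- them makes j the first letter and i the largest letter below j.
dominoPrefix-encodes : ∀ {n j i w Δ} → Encodes n w Δ → i < j → NextFirst≡ i Δ →
  Any (λ d → j ∈ entries d) Δ → (∀ {z} → z ∈ w → ¬ (i < z × z < j)) →
  Encodes n (swapVals j i w) (dom j i ∷ Δ)
dominoPrefix-encodes {w = []} encodes _ next-i _ _ with CodeShape.leads (encodes-shape encodes)
... | refl = ⊥-elim next-i
dominoPrefix-encodes {j = j} {i} {x ∷ []} {Δ} encodes i<j next-i j∈Δ _ =
  ⊥-elim (<-irrefl (trans (sym x≡i) (sym j≡x)) i<j)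
  where
  open CodeShape (encodes-shape encodes)
  x≡i : x ≡ i
  x≡i = nextFirst≡-unique Δ leads next-i
  j≡x : j ≡ x
  j≡x with Any-entries-⊆ entries⊆ j∈Δ
  ... | here j≡x = j≡x
dominoPrefix-encodes {n} {j} {i} {x ∷ p₂ ∷ rest} {Δ} encodes i<j next-i j∈Δ gap
  with nextFirst≡-unique Δ (CodeShape.leads (encodes-shape encodes)) next-i
... | refl = record
  { valid    = valid′
  ; computes = λ { (suc f) (s≤s μ≤f) → begin
      ψ-go (suc f) W                                    ≡⟨ cong (ψ-go (suc f)) W≡ ⟩
      ψ-go (suc f) (j ∷ p₂ ∷ rest′)                     ≡⟨ ψ-go-domino step ⟩
      dom j i ∷ ψ-go f (swapVals j i (j ∷ p₂ ∷ rest′))  ≡⟨ cong (λ u → dom j i ∷ ψ-go f u) unswap ⟩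
      dom j i ∷ ψ-go f w                                ≡⟨ cong (dom j i ∷_) (computes f (measure-w< μ≤f)) ⟩
      dom j i ∷ Δ                                       ∎ }
  }
  where
  open ≡-Reasoning
  open Encodes encodes
  w W rest′ : List ℕ
  w = i ∷ p₂ ∷ rest
  W = swapVals j i w
  rest′ = swapVals j i rest
  p₂<i : p₂ < i
  p₂<i = downUp-descent (DownUpWord.downUp valid)
  j∈w : j ∈ w
  j∈w = Any-entries-⊆ (CodeShape.entries⊆ (encodes-shape encodes)) j∈Δ
  W≡ : W ≡ j ∷ p₂ ∷ rest′
  W≡ = cong₂ _∷_ (swapVal-snd j i) (cong (_∷ rest′) (swapVal-other j i (<⇒≢ (<-trans p₂<i i<j)) (<⇒≢ p₂<i)))
  unswap : swapVals j i (j ∷ p₂ ∷ rest′) ≡ w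
  unswap = trans (cong (swapVals j i) (sym W≡)) (swapVals-involutive j i w)
  valid′ : DownUpWord n W
  valid′ = downUpWord (Unique.map⁺ (swapVal-injective j i) (DownUpWord.unique valid))
    (swapVals-downUp i<j p₂<i (inj₁ refl) (DownUpWord.unique valid) gap (DownUpWord.downUp valid))
    (All.tabulate (All.lookup (DownUpWord.inRange valid) ∘ swapVals-⊆ j∈w (here refl)))
  step : LargestBetween p₂ j (j ∷ p₂ ∷ rest′) (just i)
  step = some (subst (i ∈_) W≡ (swapVals-⊇ j∈w (here refl) (here refl))) p₂<i i<j
    λ {z} z∈ p₂<z z<j → ≮⇒≥ λ i<z → gap (swapVals-⊆ j∈w (here refl) (subst (z ∈_) (sym W≡) z∈)) (i<z , z<j)
  measure-w< : ∀ {f} → measure n W ≤ f → measure n w < f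
  measure-w< {f} μ≤f = <-≤-trans
    (subst (λ u → measure n u < measure n (j ∷ p₂ ∷ rest′)) unswap (dominoStep-measure n (p₂ ∷ rest′) i<j))
    (subst (λ u → measure n u ≤ f) W≡ μ≤f)

firstEntry≤ : ∀ {n} d → DominoOn n d → firstEntry d ≤ n
firstEntry≤ (dom j i)  (_ , _ , j≤n)        = j≤n
firstEntry≤ (star j i) (inj₁ (_ , _ , j≤n)) = j≤n
firstEntry≤ (star j i) (inj₂ (refl , _))    = ≤-refl

nextFirst>-top : ∀ {n Δ} → All (DominoOn n) Δ → NextFirst> n Δ → Δ ≡ []
nextFirst>-top []       _   = refl
nextFirst>-top (on ∷ _) n<d = ⊥-elim (<⇒≱ n<d (firstEntry≤ _ on))

starEntries-snoc-++ : ∀ E d Δ → starEntries ((E ++ d ∷ []) ++ Δ) ≡ starEntries (E ++ d ∷ Δ)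
starEntries-snoc-++ E d Δ = cong starEntries (++-assoc E (d ∷ []) Δ)

-- E is the part of the encoding sequence already read; only its starred
-- entries matter, as witnesses for condition (iii).
decode-encodes : ∀ {n} E Δ → 1 ≤ n → All (DominoOn n) Δ → EncCond E Δ → Unique (starEntries (E ++ Δ)) →
  Encodes n (decode Δ) Δ
decode-encodes E [] _ _ _ _ = record { valid = downUpWord [] du[] [] ; computes = λ _ _ → refl }
decode-encodes {n} E (star j i ∷ Δ) 1≤n (inj₂ (refl , refl) ∷ ons) ((above , _) , _) _
  with nextFirst>-top ons above
... | refl = subst (λ w → Encodes n w (star n n ∷ [])) (sym (cong (_++ []) (entries-star-diag n))) record
  { valid = downUpWord ([] ∷ []) du[ n ] ((1≤n , ≤-refl) ∷ []) ; computes = λ _ _ → refl }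
decode-encodes {n} E (star j i ∷ Δ) 1≤n (inj₁ (1≤i , i<j , j≤n) ∷ ons) ((above , outside) , enc) uniq =
  subst (λ w → Encodes n w (star j i ∷ Δ)) (sym (cong (_++ decode Δ) (entries-star j≢i)))
    (starPrefix-encodes encodes 1≤i i<j j≤n stars-unique above outside)
  where
  j≢i : j ≢ i
  j≢i = >⇒≢ i<j
  encodes : Encodes n (decode Δ) Δ
  encodes = decode-encodes (E ++ star j i ∷ []) Δ 1≤n ons enc
    (subst Unique (sym (starEntries-snoc-++ E _ Δ)) uniq)
  stars-unique : Unique (j ∷ i ∷ starEntries Δ)
  stars-unique = unique-++⁻ʳ (starEntries E) (subst Unique split uniq)
    where
    split : starEntries (E ++ star j i ∷ Δ) ≡ starEntries E ++ j ∷ i ∷ starEntries Δ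
    split = trans (starEntries-++ E (star j i ∷ Δ)) (cong (starEntries E ++_) (starEntries-star Δ j≢i))
decode-encodes {n} E (dom j i ∷ Δ) 1≤n ((_ , i<j , _) ∷ ons) ((_ , j∈Δ , next-i , between) , enc) uniq =
  dominoPrefix-encodes encodes i<j next-i j∈Δ gap
  where
  encodes : Encodes n (decode Δ) Δ
  encodes = decode-encodes (E ++ dom j i ∷ []) Δ 1≤n ons enc
    (subst Unique (sym (starEntries-snoc-++ E _ Δ)) uniq)
  gap : ∀ {z} → z ∈ decode Δ → ¬ (i < z × z < j)
  gap {z} z∈ (i<z , z<j) =
    unique-++-disjoint (starEntries E) (subst Unique (starEntries-++ E (dom j i ∷ Δ)) uniq)
      (between z i<z z<j) (CodeShape.stars⊇ (encodes-shape encodes) z∈)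

measure-< : ∀ {n w} → DownUpWord n w → measure n w < n * n + 2 * n + 1
measure-< {n} {w} (downUpWord uniq _ inRange) = begin-strict
  lead w + length w * n    ≤⟨ +-mono-≤ (lead≤ inRange) (*-monoˡ-≤ n length≤) ⟩
  n + suc n * n            ≡⟨ rearrange n ⟩
  n * n + 2 * n            <⟨ m<m+n _ z<s ⟩
  n * n + 2 * n + 1        ∎
  where
  open ≤-Reasoning
  rearrange : ∀ m → m + suc m * m ≡ m * m + 2 * m
  rearrange = solve-∀
  length≤ : length w ≤ suc n
  length≤ = subst (length w ≤_) (length-upTo (suc n))
    (unique-⊆-length uniq (λ x∈ → ∈-upTo⁺ (s≤s (proj₂ (All.lookup inRange x∈)))))

isPermOf-⊆⊇ : ∀ {n xs ys} → Unique ys → xs ⊆ ys → ys ⊆ xs → IsPermOf[ n ] xs → IsPermOf[ n ] ys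
isPermOf-⊆⊇ uniq xs⊆ys ys⊆xs (_ , xs⇔[n]) =
  uniq , λ x → mk⇔ (Equivalence.to (xs⇔[n] x) ∘ ys⊆xs) (xs⊆ys ∘ Equivalence.from (xs⇔[n] x))

DU⇒DownUpWord : ∀ {n π} → DU n π → DownUpWord n π
DU⇒DownUpWord ((uniq , π⇔[n]) , du) = downUpWord uniq du (All.tabulate (Equivalence.to (π⇔[n] _)))

startsWith : ∀ {k Δ} → NextFirst≡ k Δ → ∃ λ d → ∃ λ rest → Δ ≡ d ∷ rest × firstEntry d ≡ k
startsWith {Δ = d ∷ rest} first≡k = d , rest , refl , first≡k

ψ-encodes : ∀ {n k π} → 1 ≤ n → DUk n k π → ESk n k (ψ n π)
ψ-encodes {n} {k} {π} 1≤n (du@((_ , π⇔[n]) , _) , rest , refl) =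
  (proj₁ encoding , isPermOf-⊆⊇ stars-unique stars⊇ stars⊆ (proj₁ du) , proj₂ encoding) , startsWith leads
  where
  valid : DownUpWord n π
  valid = DU⇒DownUpWord du
  open CodeShape (ψ-go-shape _ π (valid , measure-< valid))
  encoding : All (DominoOn n) (ψ n π) × EncCond [] (ψ n π)
  encoding = ψ-go-encodes _ π [] (valid , measure-< valid)
    (inj₂ (Equivalence.from (π⇔[n] n) (1≤n , ≤-refl))) (inj₁ ∘ Equivalence.from (π⇔[n] _))

decode-ψ : ∀ {n k π} → DUk n k π → decode (ψ n π) ≡ π
decode-ψ (du , _) = decode-ψ-go _ _ (DU⇒DownUpWord du , measure-< (DU⇒DownUpWord du))

codeShape-DUk : ∀ {n k w d rest} → DownUpWord n w → CodeShape w (d ∷ rest) → firstEntry d ≡ k →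
  IsPermOf[ n ] (starEntries (d ∷ rest)) → DUk n k w
codeShape-DUk {w = []} _ shape _ _ with CodeShape.leads shape
... | ()
codeShape-DUk {w = x ∷ w} valid shape first≡k stars-perm =
  (isPermOf-⊆⊇ (DownUpWord.unique valid) stars⊆ stars⊇ stars-perm , DownUpWord.downUp valid) ,
  w , cong (_∷ w) (trans (sym leads) first≡k)
  where open CodeShape shape

decode-encodesₖ : ∀ {n k Δ} → 1 ≤ n → ESk n k Δ → Encodes n (decode Δ) Δ
decode-encodesₖ {Δ = Δ} 1≤n ((ons , stars-perm , enc) , _) = decode-encodes [] Δ 1≤n ons enc (proj₁ stars-perm)

decode-DUk : ∀ {n k Δ} → 1 ≤ n → ESk n k Δ → DUk n k (decode Δ)
decode-DUk {n} {Δ = Δ} 1≤n es@((_ , stars-perm , _) , _ , _ , refl , first≡k) =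
  codeShape-DUk (Encodes.valid encodes) (encodes-shape encodes) first≡k stars-perm
  where
  encodes : Encodes n (decode Δ) Δ
  encodes = decode-encodesₖ 1≤n es

ψ-decode : ∀ {n k Δ} → 1 ≤ n → ESk n k Δ → ψ n (decode Δ) ≡ Δ
ψ-decode 1≤n es = computes _ (measure-< valid)
  where open Encodes (decode-encodesₖ 1≤n es)

theorem4 : (n k : ℕ) → 1 ≤ n → 1 ≤ k → k ≤ n →
    ((π : List ℕ) → DUk n k π → ESk n k (ψ n π)) ×
    ((π σ : List ℕ) → DUk n k π → DUk n k σ → ψ n π ≡ ψ n σ → π ≡ σ) ×
    ((Δ : List Domino) → ESk n k Δ → ∃ λ π → DUk n k π × ψ n π ≡ Δ) ×
    ((m : ℕ) → HasCard (DUk n k) m ⇔ HasCard (ESk n k) m)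
theorem4 n k 1≤n _ _ =
    (λ π → ψ-encodes 1≤n)
  , (λ π σ π-du σ-du ψπ≡ψσ → trans (sym (decode-ψ π-du)) (trans (cong decode ψπ≡ψσ) (decode-ψ σ-du)))
  , (λ Δ es → decode Δ , decode-DUk 1≤n es , ψ-decode 1≤n es)
  , λ m → mk⇔ (HasCard-map (ψ n) decode (ψ-encodes 1≤n) (decode-DUk 1≤n) decode-ψ (ψ-decode 1≤n))
              (HasCard-map decode (ψ n) (decode-DUk 1≤n) (ψ-encodes 1≤n) (ψ-decode 1≤n) decode-ψ)
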